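{- Let $\mathcal{B}=\{B(k)\colon k\in\mathbb{N}_0\setminus\{1\}\}$. If $x\in\mathcal{B}$, then every positive divisor of $x$ is in $\mathcal{B}$.
   Context: Let $\overline{\psi}$ be the multiplicative arithmetic function with $\overline{\psi}(p^{\alpha})=p^{\alpha-1}(p+1)$ for odd primes $p$ and $\overline{\psi}(2^{\alpha})=2^{\alpha-1}$, for all positive integers $\alpha$ (so $\overline{\psi}(1)=1$). For $n>1$, $\lambda(n)$ is the unique nonnegative integer with $\overline{\psi}^{\lambda(n)}(n)=2$ (where $\overline{\psi}^k$ is the $k$-th iterate, $\overline{\psi}^0(n)=n$), and $\lambda(1)=0$. $\mathbb{N}_0$ is the set of nonnegative integers. For each nonnegative integer $k\neq 1$, $B(k)$ denotes the largest odd positive integer $n$ with $\lambda(n)=k$ (such a number exists). -}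

module Defs where

open import Data.Nat using (ℕ; zero; suc; _+_; _*_; _^_; _≤_; _<_; _/_)
open import Data.Nat.Divisibility using (_∣_; _∣?_)
open import Data.Nat.Primality using (Prime; prime?)
open import Data.Bool using (if_then_else_)
open import Data.List using (List; map; upTo)
open import Data.Nat.ListAction using (product)
open import Data.Product using (_×_; ∃-syntax)
open import Data.Sum using (_⊎_)
open import Relation.Nullary using (¬_; does)
open import Relation.Binary.PropositionalEquality using (_≡_; _≢_)

val' : ℕ → ℕ → ℕ → ℕ
val' zero    q n = 0
val' (suc f) q n =
  if does (suc (suc q) ∣? n) then suc (val' f q (n / suc (suc q))) else 0

-- v_p(n) for p = q + 2 and n ≥ 1 (fuel n suffices, since p^v ≤ n)
val : ℕ → ℕ → ℕ
val q n = val' n q n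

-- value of ψ̄ at p^a : ψ̄(1) = 1, ψ̄(2^a) = 2^(a-1), ψ̄(p^a) = p^(a-1)(p+1) for odd p
local : ℕ → ℕ → ℕ
local p zero    = 1
local p (suc a) = if does (p Data.Nat.≟ 2) then 2 ^ a else p ^ a * (p + 1)

-- ψ̄(n) for n ≥ 1 : the multiplicative function ∏_{p prime} ψ̄(p^{v_p(n)}),
-- the product ranging over all primes p = q + 2 ≤ n + 1 (enough, since p ∣ n ⇒ p ≤ n).
psiBar : ℕ → ℕ
psiBar n = product (map (λ q → if does (prime? (suc (suc q))) then local (suc (suc q)) (val q n) else 1) (upTo n))

iter : ℕ → (ℕ → ℕ) → ℕ → ℕ
iter zero    f n = n
iter (suc k) f n = f (iter k f n)

LambdaIs : ℕ → ℕ → Set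
LambdaIs n k = (n ≡ 1 × k ≡ 0) ⊎ (1 < n × iter k psiBar n ≡ 2)

Odd : ℕ → Set
Odd n = ¬ (2 ∣ n)

IsB : ℕ → ℕ → Set
IsB k x = (Odd x × 1 ≤ x × LambdaIs x k)
        × (∀ m → Odd m → 1 ≤ m → LambdaIs m k → m ≤ x)

InℬB : ℕ → Set
InℬB x = ∃[ k ] (k ≢ 1 × IsB k x)

-- Give the prime 2 weight 1 and an odd prime p the weight w(p) = height (p + 1), where height is
-- the completely additive function with height p = w(p).  Since ψ̄(p^a) = p^(a-1) (p + 1), every
-- application of ψ̄ preserves the height of an odd number and lowers that of an even one by 1, and
-- ψ̄ n is even for n > 2; hence λ(n) = height n for odd n, and B(k) is the largest odd x of
-- height k.  If x = e d is such a number and m is odd with height m = height d, then e m is odd of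
-- height k, so e m ≤ e d and m ≤ d: thus d = B(height d).  Finally height d ≠ 1, because an odd
-- d > 1 has an odd prime factor p, and w(p) = 1 + height ((p + 1) / 2) ≥ 2.
module Submission where

open import Defs
open import Data.Nat
open import Data.Nat.Properties
open import Data.Nat.Divisibility
open import Data.Nat.DivMod using (m*n/n≡m)
open import Data.Nat.Primality
open import Data.Nat.Primality.Factorisation using (factorise; PrimeFactorisation)
open import Data.Nat.ListAction using (sum; product)
open import Data.Bool using (true; false; if_then_else_)
open import Data.List using ([]; _∷_; applyUpTo)
open import Data.List.Properties using (map-upTo)
open import Data.List.Relation.Unary.All using (All; _∷_)
open import Data.Product using (∃-syntax; _×_; _,_)
open import Data.Sum using (_⊎_; inj₁; inj₂; [_,_]′)
open import Function using (_∘_)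
open import Relation.Nullary using (¬_; does; yes; no; contradiction)
open import Relation.Nullary.Decidable using (dec-true; dec-false)
open import Relation.Binary.PropositionalEquality
open import Algebra.Properties.CommutativeSemigroup +-commutativeSemigroup using ()
  renaming (interchange to +-interchange)
open import Algebra.Properties.CommutativeSemigroup *-commutativeSemigroup using ()
  renaming (interchange to *-interchange)

m*n>0⇒m>0 : ∀ m {n} → 1 ≤ m * n → 1 ≤ m
m*n>0⇒m>0 (suc _) _ = z<s

sum-applyUpTo-cong : ∀ {f g : ℕ → ℕ} n → (∀ {i} → i < n → f i ≡ g i) →
                     sum (applyUpTo f n) ≡ sum (applyUpTo g n)
sum-applyUpTo-cong         zero    f≗g = refl
sum-applyUpTo-cong {f} {g} (suc n) f≗g =
  cong₂ _+_ (f≗g z<s) (sum-applyUpTo-cong {f ∘ suc} {g ∘ suc} n (f≗g ∘ s<s))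

sum-applyUpTo-+ : ∀ (f g : ℕ → ℕ) n →
                  sum (applyUpTo (λ i → f i + g i) n) ≡ sum (applyUpTo f n) + sum (applyUpTo g n)
sum-applyUpTo-+ f g zero    = refl
sum-applyUpTo-+ f g (suc n) = begin
  f 0 + g 0 + sum (applyUpTo (λ i → f (suc i) + g (suc i)) n)
    ≡⟨ cong (f 0 + g 0 +_) (sum-applyUpTo-+ (f ∘ suc) (g ∘ suc) n) ⟩
  f 0 + g 0 + (sum (applyUpTo (f ∘ suc) n) + sum (applyUpTo (g ∘ suc) n))
    ≡⟨ +-interchange (f 0) (g 0) _ _ ⟩
  f 0 + sum (applyUpTo (f ∘ suc) n) + (g 0 + sum (applyUpTo (g ∘ suc) n)) ∎
  where open ≡-Reasoning

sum-applyUpTo-extend : ∀ (f : ℕ → ℕ) {m n} → m ≤ n → (∀ {i} → m ≤ i → f i ≡ 0) →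
                       sum (applyUpTo f n) ≡ sum (applyUpTo f m)
sum-applyUpTo-extend f {zero}  {zero}  _   _   = refl
sum-applyUpTo-extend f {zero}  {suc n} _   f≡0 =
  cong₂ _+_ (f≡0 z≤n) (sum-applyUpTo-extend (f ∘ suc) {zero} {n} z≤n (λ _ → f≡0 z≤n))
sum-applyUpTo-extend f {suc m} {suc n} m≤n f≡0 =
  cong (f 0 +_) (sum-applyUpTo-extend (f ∘ suc) (s≤s⁻¹ m≤n) (f≡0 ∘ s≤s))

sum-applyUpTo-single : ∀ (f : ℕ → ℕ) {i n} → i < n → (∀ {j} → j ≢ i → f j ≡ 0) →
                       sum (applyUpTo f n) ≡ f i
sum-applyUpTo-single f {zero}  {suc n} _   f≡0 =
  trans (cong (f 0 +_) (sum-applyUpTo-extend (f ∘ suc) {zero} {n} z≤n (λ _ → f≡0 λ ())))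
        (+-identityʳ (f 0))
sum-applyUpTo-single f {suc i} {suc n} i<n f≡0 =
  trans (cong (_+ sum (applyUpTo (f ∘ suc) n)) (f≡0 λ ()))
        (sum-applyUpTo-single (f ∘ suc) (s<s⁻¹ i<n) (λ j≢i → f≡0 (j≢i ∘ suc-injective)))

product-applyUpTo-pos : ∀ (f : ℕ → ℕ) n → (∀ i → 1 ≤ f i) → 1 ≤ product (applyUpTo f n)
product-applyUpTo-pos f zero    f≥1 = ≤-refl
product-applyUpTo-pos f (suc n) f≥1 =
  *-mono-≤ (f≥1 0) (product-applyUpTo-pos (f ∘ suc) n (f≥1 ∘ suc))

∣-product-applyUpTo : ∀ (f : ℕ → ℕ) {i n d} → i < n → d ∣ f i → d ∣ product (applyUpTo f n)
∣-product-applyUpTo f {zero}  {suc n} _   d∣fi = ∣m⇒∣m*n _ d∣fi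
∣-product-applyUpTo f {suc i} {suc n} i<n d∣fi =
  ∣n⇒∣m*n (f 0) (∣-product-applyUpTo (f ∘ suc) (s<s⁻¹ i<n) d∣fi)

CompletelyAdditive : (ℕ → ℕ) → Set
CompletelyAdditive F = ∀ {a b} → 1 ≤ a → 1 ≤ b → F (a * b) ≡ F a + F b

module _ (F : ℕ → ℕ) (F-* : CompletelyAdditive F) where

  additive-1 : F 1 ≡ 0
  additive-1 = +-cancelˡ-≡ (F 1) _ _ (trans (sym (F-* ≤-refl ≤-refl)) (sym (+-identityʳ (F 1))))

  additive-^ : ∀ {a} → 1 ≤ a → ∀ k → F (a ^ k) ≡ k * F a
  additive-^ a≥1 zero    = additive-1
  additive-^ a≥1 (suc k) =
    trans (F-* a≥1 (m^n>0 _ ⦃ >-nonZero a≥1 ⦄ k)) (cong (F _ +_) (additive-^ a≥1 k))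

  additive-product : ∀ (f : ℕ → ℕ) → (∀ i → 1 ≤ f i) → ∀ n →
                     F (product (applyUpTo f n)) ≡ sum (applyUpTo (F ∘ f) n)
  additive-product f f≥1 zero    = additive-1
  additive-product f f≥1 (suc n) =
    trans (F-* (f≥1 0) (product-applyUpTo-pos (f ∘ suc) n (f≥1 ∘ suc)))
          (cong (F (f 0) +_) (additive-product (f ∘ suc) (f≥1 ∘ suc) n))

  additive-∣⇒≤ : ∀ {d n} → 1 ≤ n → d ∣ n → F d ≤ F n
  additive-∣⇒≤ {zero}  n≥1 0∣n = contradiction (0∣⇒≡0 0∣n) (>⇒≢ n≥1)
  additive-∣⇒≤ {suc d} n≥1 (divides q refl) =
    ≤-trans (m≤n+m (F (suc d)) (F q)) (≤-reflexive (sym (F-* (m*n>0⇒m>0 q n≥1) z<s)))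

2∣⊎2∣suc : ∀ n → 2 ∣ n ⊎ 2 ∣ suc n
2∣⊎2∣suc zero    = inj₁ (divides 0 refl)
2∣⊎2∣suc (suc n) with 2∣⊎2∣suc n
... | inj₁ (divides q refl) = inj₂ (divides (suc q) refl)
... | inj₂ 2∣1+n            = inj₁ 2∣1+n

odd-* : ∀ {a b} → Odd a → Odd b → Odd (a * b)
odd-* a-odd b-odd 2∣ab = [ a-odd , b-odd ]′ (euclidsLemma _ _ prime[2] 2∣ab)

odd-∣ : ∀ {d n} → Odd n → d ∣ n → Odd d
odd-∣ n-odd d∣n 2∣d = n-odd (∣-trans 2∣d d∣n)

prime∣2⇒≡2 : ∀ {p} → Prime p → 2 ∣ p → p ≡ 2
prime∣2⇒≡2 p-prime 2∣p = [ (λ ()) , sym ]′ (prime⇒irreducible p-prime 2∣p)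

2∣suc-oddPrime : ∀ {p} → Prime p → p ≢ 2 → 2 ∣ suc p
2∣suc-oddPrime {p} p-prime p≢2 with 2∣⊎2∣suc p
... | inj₁ 2∣p   = contradiction (prime∣2⇒≡2 p-prime 2∣p) p≢2
... | inj₂ 2∣1+p = 2∣1+p

prime∣suc-oddPrime⇒< : ∀ {p d} → Prime p → p ≢ 2 → Prime d → d ∣ suc p → d < p
prime∣suc-oddPrime⇒< {p} {d} p-prime p≢2 d-prime d∣1+p =
  ≤∧≢⇒< (s≤s⁻¹ (≤∧≢⇒< (∣⇒≤ d∣1+p) d≢1+p)) d≢p
  where
    d≢1+p : d ≢ suc p
    d≢1+p refl with prime∣2⇒≡2 d-prime (2∣suc-oddPrime p-prime p≢2)
    ... | refl = ¬prime[1] p-prime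
    d≢p : d ≢ p
    d≢p refl = ¬prime[1] (subst Prime (∣1⇒≡1 (∣m+n∣m⇒∣n (subst (d ∣_) (+-comm 1 d) d∣1+p) ∣-refl)) d-prime)

prime-factor : ∀ {n} → 1 < n → ∃[ q ] (Prime (2 + q) × 2 + q ∣ n)
prime-factor {n} n>1 = go (factors F) (isFactorisation F) (factorsPrime F)
  where
    open PrimeFactorisation
    F : PrimeFactorisation n
    F = factorise n ⦃ >-nonZero (<-trans z<s n>1) ⦄
    go : ∀ ps → n ≡ product ps → All Prime ps → ∃[ q ] (Prime (2 + q) × 2 + q ∣ n)
    go []                 n≡1 _             = contradiction n≡1 (>⇒≢ n>1)
    go (0 ∷ _)            _   (0-prime ∷ _) = contradiction 0-prime ¬prime[0]
    go (1 ∷ _)            _   (1-prime ∷ _) = contradiction 1-prime ¬prime[1]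
    go (suc (suc q) ∷ ps) n≡  (p-prime ∷ _) =
      q , p-prime , divides (product ps) (trans n≡ (*-comm (2 + q) (product ps)))

oddPrime-factor : ∀ {n} → 1 < n → Odd n → ∃[ q ] (Prime (3 + q) × 3 + q ∣ n)
oddPrime-factor n>1 n-odd with prime-factor n>1
... | zero  , _       , 2∣n = contradiction 2∣n n-odd
... | suc q , p-prime , p∣n = q , p-prime , p∣n

-- p-adic valuations

ExactPower : ℕ → ℕ → ℕ → Set
ExactPower p v n = ∃[ m ] (n ≡ p ^ v * m × ¬ p ∣ m)

exactPower-unique : ∀ {p a b n} .{{_ : NonZero p}} → ExactPower p a n → ExactPower p b n → a ≡ b
exactPower-unique {p} {a} {b} (m , n≡ , p∤m) (m' , n≡' , p∤m') = go a b (trans (sym n≡) n≡')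
  where
    p∣p^1+k* : ∀ k c → p ∣ p ^ suc k * c
    p∣p^1+k* k c = ∣m⇒∣m*n c (m∣m*n (p ^ k))
    go : ∀ a b → p ^ a * m ≡ p ^ b * m' → a ≡ b
    go zero    zero    _  = refl
    go zero    (suc b) eq = contradiction (subst (p ∣_) (trans (sym eq) (*-identityˡ m)) (p∣p^1+k* b m')) p∤m
    go (suc a) zero    eq = contradiction (subst (p ∣_) (trans eq (*-identityˡ m')) (p∣p^1+k* a m)) p∤m'
    go (suc a) (suc b) eq = cong suc (go a b (*-cancelˡ-≡ _ _ p
      (trans (sym (*-assoc p (p ^ a) m)) (trans eq (*-assoc p (p ^ b) m')))))

val'-∣ : ∀ f q {n} → 2 + q ∣ n → val' (suc f) q n ≡ suc (val' f q (n / (2 + q)))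
val'-∣ f q {n} p∣n =
  cong (λ b → if b then suc (val' f q (n / (2 + q))) else 0) (dec-true (2 + q ∣? n) p∣n)

val'-∤ : ∀ f q {n} → ¬ 2 + q ∣ n → val' (suc f) q n ≡ 0
val'-∤ f q {n} p∤n =
  cong (λ b → if b then suc (val' f q (n / (2 + q))) else 0) (dec-false (2 + q ∣? n) p∤n)

val'-exactPower : ∀ f q {n} → 1 ≤ n → n ≤ f → ExactPower (2 + q) (val' f q n) n
val'-exactPower zero    q n≥1 n≤0 = contradiction (≤-trans n≥1 n≤0) λ ()
val'-exactPower (suc f) q {n} n≥1 n≤1+f with 2 + q ∣? n
... | no p∤n rewrite val'-∤ f q p∤n = n , sym (*-identityˡ n) , p∤n
... | yes (divides zero refl) = contradiction n≥1 λ ()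
... | yes p∣n@(divides m@(suc _) refl) rewrite val'-∣ f q p∣n | m*n/n≡m m (2 + q) ⦃ _ ⦄
  with val'-exactPower f q {m} z<s (s≤s⁻¹ (<-≤-trans (m<m*n m (2 + q) (s≤s (s≤s z≤n))) n≤1+f))
...   | m' , m≡ , p∤m' = m' , trans (cong (_* (2 + q)) m≡) p^v*m'*p≡ , p∤m'
  where
    p^v*m'*p≡ : (2 + q) ^ val' f q m * m' * (2 + q) ≡ (2 + q) ^ suc (val' f q m) * m'
    p^v*m'*p≡ = trans (*-comm ((2 + q) ^ val' f q m * m') (2 + q))
                      (sym (*-assoc (2 + q) ((2 + q) ^ val' f q m) m'))

val-exactPower : ∀ q {n} → 1 ≤ n → ExactPower (2 + q) (val q n) n
val-exactPower q {n} n≥1 = val'-exactPower n q n≥1 ≤-refl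

val-unique : ∀ q {n v} → 1 ≤ n → ExactPower (2 + q) v n → val q n ≡ v
val-unique q n≥1 = exactPower-unique (val-exactPower q n≥1)

val-∤ : ∀ q {n} → 1 ≤ n → ¬ 2 + q ∣ n → val q n ≡ 0
val-∤ q {n} n≥1 p∤n = val-unique q n≥1 (n , sym (*-identityˡ n) , p∤n)

val>0⇒∣ : ∀ q {n} → 1 ≤ n → 1 ≤ val q n → 2 + q ∣ n
val>0⇒∣ q {n} n≥1 v≥1 with val q n | val-exactPower q n≥1
... | suc v | m , n≡ , _ = subst (2 + q ∣_) (sym n≡) (∣m⇒∣m*n m (m∣m*n ((2 + q) ^ v)))

∣⇒val>0 : ∀ q {n} → 1 ≤ n → 2 + q ∣ n → 1 ≤ val q n
∣⇒val>0 q {n} n≥1 p∣n with val q n | val-exactPower q n≥1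
... | zero  | m , n≡ , p∤m = contradiction (subst (2 + q ∣_) (trans n≡ (*-identityˡ m)) p∣n) p∤m
... | suc _ | _           = s≤s z≤n

val-< : ∀ q {n} → 1 ≤ n → n < 2 + q → val q n ≡ 0
val-< q n≥1 n<p = val-∤ q n≥1 (λ p∣n → <⇒≱ n<p (∣⇒≤ ⦃ >-nonZero n≥1 ⦄ p∣n))

val-self : ∀ q → val q (2 + q) ≡ 1
val-self q = val-unique q z<s
  (1 , sym (trans (*-identityʳ _) (*-identityʳ _)) , λ p∣1 → contradiction (∣1⇒≡1 p∣1) λ ())

val-prime-other : ∀ {q} r → Prime (2 + q) → r ≢ q → val r (2 + q) ≡ 0
val-prime-other r p-prime r≢q = val-∤ r z<s λ p'∣p →
  [ (λ ()) , (λ p'≡p → r≢q (suc-injective (suc-injective p'≡p))) ]′ (prime⇒irreducible p-prime p'∣p)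

val-* : ∀ q {a b} → Prime (2 + q) → 1 ≤ a → 1 ≤ b → val q (a * b) ≡ val q a + val q b
val-* q {a} {b} p-prime a≥1 b≥1 with val-exactPower q a≥1 | val-exactPower q b≥1
... | a' , a≡ , p∤a' | b' , b≡ , p∤b' = val-unique q (*-mono-≤ a≥1 b≥1)
  (a' * b' , ab≡ , λ p∣a'b' → [ p∤a' , p∤b' ]′ (euclidsLemma a' b' p-prime p∣a'b'))
  where
    p = 2 + q
    ab≡ : a * b ≡ p ^ (val q a + val q b) * (a' * b')
    ab≡ = begin
      a * b                                   ≡⟨ cong₂ _*_ a≡ b≡ ⟩
      p ^ val q a * a' * (p ^ val q b * b')   ≡⟨ *-interchange (p ^ val q a) a' (p ^ val q b) b' ⟩
      p ^ val q a * p ^ val q b * (a' * b')   ≡⟨ cong (_* (a' * b')) (^-distribˡ-+-* p (val q a) (val q b)) ⟨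
      p ^ (val q a + val q b) * (a' * b')     ∎
      where open ≡-Reasoning

-- Weights of primes and the height function

heightWith : (ℕ → ℕ) → ℕ → ℕ
heightWith w n = sum (applyUpTo (λ r → val r n * w r) n)

-- weightF f q is the weight of the prime q + 2 computed with fuel f.  The prime factors of p + 1
-- are smaller than the odd prime p, so fuel q + 1 suffices (weightF-fuel).
weightF : ℕ → ℕ → ℕ
weightF zero    _       = 0
weightF (suc f) zero    = 1
weightF (suc f) (suc q) = if does (prime? (3 + q)) then heightWith (weightF f) (4 + q) else 0

weight : ℕ → ℕ
weight q = weightF (suc q) q

height : ℕ → ℕ
height = heightWith weight

weightF-nonprime : ∀ f {q} → ¬ Prime (2 + q) → weightF f q ≡ 0
weightF-nonprime zero    _         = refl
weightF-nonprime (suc f) {zero}  ¬p = contradiction prime[2] ¬p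
weightF-nonprime (suc f) {suc q} ¬p =
  cong (λ b → if b then heightWith (weightF f) (4 + q) else 0) (dec-false (prime? (3 + q)) ¬p)

weightF-oddPrime : ∀ f {q} → Prime (3 + q) → weightF (suc f) (suc q) ≡ heightWith (weightF f) (4 + q)
weightF-oddPrime f {q} p-prime =
  cong (λ b → if b then heightWith (weightF f) (4 + q) else 0) (dec-true (prime? (3 + q)) p-prime)

heightWith-oddPrime-cong : ∀ {q} {w w' : ℕ → ℕ} → Prime (3 + q) →
                           (∀ {r} → (Prime (2 + r) → r ≤ q) → w r ≡ w' r) →
                           heightWith w (4 + q) ≡ heightWith w' (4 + q)
heightWith-oddPrime-cong {q} {w} {w'} p-prime w≗w' = sum-applyUpTo-cong (4 + q) (λ {r} _ → term r)
  where
    term : ∀ r → val r (4 + q) * w r ≡ val r (4 + q) * w' r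
    term r with val r (4 + q) in v≡
    ... | zero  = refl
    ... | suc v = cong (suc v *_) (w≗w' λ p' → s≤s⁻¹ (s≤s⁻¹ (s<s⁻¹ (prime∣suc-oddPrime⇒< p-prime (λ ()) p'
                    (val>0⇒∣ r z<s (subst (1 ≤_) (sym v≡) z<s))))))

weightF-fuel : ∀ {q} f f' → q < f → q < f' → weightF f q ≡ weightF f' q
weightF-fuel {zero}  (suc f) (suc f') _         _          = refl
weightF-fuel {suc q} (suc f) (suc f') (s<s q<f) (s<s q<f') with prime? (3 + q)
... | no  ¬p      = trans (weightF-nonprime (suc f) ¬p) (sym (weightF-nonprime (suc f') ¬p))
... | yes p-prime = begin
  weightF (suc f) (suc q)         ≡⟨ weightF-oddPrime f p-prime ⟩
  heightWith (weightF f) (4 + q)  ≡⟨ heightWith-oddPrime-cong p-prime weightF-f≡f' ⟩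
  heightWith (weightF f') (4 + q) ≡⟨ weightF-oddPrime f' p-prime ⟨
  weightF (suc f') (suc q)        ∎
  where
    open ≡-Reasoning
    weightF-f≡f' : ∀ {r} → (Prime (2 + r) → r ≤ q) → weightF f r ≡ weightF f' r
    weightF-f≡f' {r} r≤q with prime? (2 + r)
    ... | no  ¬p' = trans (weightF-nonprime f ¬p') (sym (weightF-nonprime f' ¬p'))
    ... | yes p'  = weightF-fuel f f' (≤-<-trans (r≤q p') q<f) (≤-<-trans (r≤q p') q<f')

weight-nonprime : ∀ {q} → ¬ Prime (2 + q) → weight q ≡ 0
weight-nonprime {q} = weightF-nonprime (suc q)

weight-oddPrime : ∀ {q} → Prime (3 + q) → weight (suc q) ≡ height (4 + q)
weight-oddPrime {q} p-prime =
  trans (weightF-oddPrime (suc q) p-prime) (heightWith-oddPrime-cong p-prime weightF≡weight)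
  where
    weightF≡weight : ∀ {r} → (Prime (2 + r) → r ≤ q) → weightF (suc q) r ≡ weight r
    weightF≡weight {r} r≤q with prime? (2 + r)
    ... | no  ¬p = trans (weightF-nonprime (suc q) ¬p) (sym (weight-nonprime ¬p))
    ... | yes p  = weightF-fuel (suc q) (suc r) (s≤s (r≤q p)) ≤-refl

height-extend : ∀ {n N} → 1 ≤ n → n ≤ N → sum (applyUpTo (λ r → val r n * weight r) N) ≡ height n
height-extend n≥1 n≤N = sum-applyUpTo-extend _ n≤N λ {r} n≤r →
  cong (_* weight r) (val-< r n≥1 (≤-<-trans n≤r (<-trans (n<1+n r) (n<1+n (suc r)))))

height-* : CompletelyAdditive height
height-* {a} {b} a≥1 b≥1 = begin
  height (a * b)
    ≡⟨ sum-applyUpTo-cong (a * b) (λ {r} _ → term r) ⟩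
  sum (applyUpTo (λ r → val r a * weight r + val r b * weight r) (a * b))
    ≡⟨ sum-applyUpTo-+ (λ r → val r a * weight r) (λ r → val r b * weight r) (a * b) ⟩
  sum (applyUpTo (λ r → val r a * weight r) (a * b)) + sum (applyUpTo (λ r → val r b * weight r) (a * b))
    ≡⟨ cong₂ _+_ (height-extend a≥1 (m≤m*n a b ⦃ >-nonZero b≥1 ⦄))
                 (height-extend b≥1 (m≤n*m b a ⦃ >-nonZero a≥1 ⦄)) ⟩
  height a + height b ∎
  where
    open ≡-Reasoning
    term : ∀ r → val r (a * b) * weight r ≡ val r a * weight r + val r b * weight r
    term r with prime? (2 + r)
    ... | yes p = trans (cong (_* weight r) (val-* r p a≥1 b≥1)) (*-distribʳ-+ (weight r) (val r a) (val r b))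
    ... | no ¬p rewrite weight-nonprime ¬p | *-zeroʳ (val r (a * b))
                      | *-zeroʳ (val r a)    | *-zeroʳ (val r b) = refl

height-prime : ∀ {q} → Prime (2 + q) → height (2 + q) ≡ weight q
height-prime {q} p-prime =
  trans (sum-applyUpTo-single _ (<-trans (n<1+n q) (n<1+n (suc q)))
          (λ {r} r≢q → cong (_* weight r) (val-prime-other r p-prime r≢q)))
        (trans (cong (_* weight q) (val-self q)) (+-identityʳ (weight q)))

height-*2 : ∀ {m} → 1 ≤ m → height (m * 2) ≡ suc (height m)
height-*2 {m} m≥1 = trans (height-* m≥1 z<s) (+-comm (height m) 1)

weight-pos : ∀ {q} → Prime (2 + q) → 1 ≤ weight q
weight-pos {zero}  _       = ≤-refl
weight-pos {suc q} p-prime = subst (1 ≤_) (sym (weight-oddPrime p-prime))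
  (additive-∣⇒≤ height height-* z<s (2∣suc-oddPrime p-prime λ ()))

weight≤height : ∀ {q n} → Prime (2 + q) → 1 ≤ n → 2 + q ∣ n → weight q ≤ height n
weight≤height {n = n} p-prime n≥1 p∣n =
  subst (_≤ height n) (height-prime p-prime) (additive-∣⇒≤ height height-* n≥1 p∣n)

height-pos : ∀ {n} → 1 < n → 1 ≤ height n
height-pos n>1 with prime-factor n>1
... | q , p-prime , p∣n = ≤-trans (weight-pos p-prime) (weight≤height p-prime (<-trans z<s n>1) p∣n)

height≡0⇒≡1 : ∀ {n} → 1 ≤ n → height n ≡ 0 → n ≡ 1
height≡0⇒≡1 {1}           _ _  = refl
height≡0⇒≡1 {suc (suc n)} _ h≡0 = contradiction (subst (1 ≤_) h≡0 (height-pos {suc (suc n)} (s≤s z<s))) λ ()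

weight-oddPrime≥2 : ∀ {q} → Prime (3 + q) → 2 ≤ weight (suc q)
weight-oddPrime≥2 {q} p-prime with 2∣suc-oddPrime p-prime (λ ())
... | 2∣p+1@(divides m p+1≡m*2) = begin
  2               ≤⟨ s≤s (height-pos m>1) ⟩
  suc (height m)  ≡⟨ height-*2 (<-trans z<s m>1) ⟨
  height (m * 2)  ≡⟨ cong height p+1≡m*2 ⟨
  height (4 + q)  ≡⟨ weight-oddPrime p-prime ⟨
  weight (suc q)  ∎
  where
    open ≤-Reasoning
    m>1 : 1 < m
    m>1 = quotient>1 2∣p+1 (s≤s (s≤s z<s))

height-odd≥2 : ∀ {n} → 1 < n → Odd n → 2 ≤ height n
height-odd≥2 n>1 n-odd with oddPrime-factor n>1 n-odd
... | q , p-prime , p∣n = ≤-trans (weight-oddPrime≥2 p-prime) (weight≤height p-prime (<-trans z<s n>1) p∣n)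

-- ψ̄ and the height

psiFactor : ℕ → ℕ → ℕ
psiFactor n q = if does (prime? (2 + q)) then local (2 + q) (val q n) else 1

psiBar≡product : ∀ n → psiBar n ≡ product (applyUpTo (psiFactor n) n)
psiBar≡product n = cong product (map-upTo (psiFactor n) n)

psiFactor-prime : ∀ n {q} → Prime (2 + q) → psiFactor n q ≡ local (2 + q) (val q n)
psiFactor-prime n {q} p-prime =
  cong (λ b → if b then local (2 + q) (val q n) else 1) (dec-true (prime? (2 + q)) p-prime)

psiFactor-nonprime : ∀ n {q} → ¬ Prime (2 + q) → psiFactor n q ≡ 1
psiFactor-nonprime n {q} ¬p =
  cong (λ b → if b then local (2 + q) (val q n) else 1) (dec-false (prime? (2 + q)) ¬p)

local-pos : ∀ {p} → 1 ≤ p → ∀ v → 1 ≤ local p v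
local-pos p≥1 zero = ≤-refl
local-pos {p} p≥1 (suc a) with does (p ≟ 2)
... | true  = m^n>0 2 a
... | false = *-mono-≤ (m^n>0 p ⦃ >-nonZero p≥1 ⦄ a) (m≤n+m 1 p)

psiFactor-pos : ∀ n q → 1 ≤ psiFactor n q
psiFactor-pos n q with prime? (2 + q)
... | yes p-prime = subst (1 ≤_) (sym (psiFactor-prime n p-prime)) (local-pos z<s (val q n))
... | no  ¬p      = subst (1 ≤_) (sym (psiFactor-nonprime n ¬p)) ≤-refl

psiBar-pos : ∀ n → 1 ≤ psiBar n
psiBar-pos n =
  subst (1 ≤_) (sym (psiBar≡product n)) (product-applyUpTo-pos (psiFactor n) n (psiFactor-pos n))

height-local-2 : ∀ v → height (local 2 v) ≡ v ∸ 1
height-local-2 zero    = refl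
height-local-2 (suc a) = trans (additive-^ height height-* z<s a) (*-identityʳ a)

height-local-oddPrime : ∀ {q} → Prime (3 + q) → ∀ v → height (local (3 + q) v) ≡ v * weight (suc q)
height-local-oddPrime     p-prime zero    = refl
height-local-oddPrime {q} p-prime (suc a) = begin
  height (p ^ a * (p + 1))
    ≡⟨ height-* (m^n>0 p a) (m≤n+m 1 p) ⟩
  height (p ^ a) + height (p + 1)
    ≡⟨ cong₂ _+_ (additive-^ height height-* z<s a) (cong height (+-comm p 1)) ⟩
  a * height p + height (suc p)
    ≡⟨ cong₂ _+_ (cong (a *_) (height-prime p-prime)) (sym (weight-oddPrime p-prime)) ⟩
  a * weight (suc q) + weight (suc q)
    ≡⟨ +-comm (a * weight (suc q)) (weight (suc q)) ⟩
  suc a * weight (suc q) ∎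
  where
    open ≡-Reasoning
    p = 3 + q

height-psiFactor-2 : ∀ n → height (psiFactor n 0) ≡ val 0 n ∸ 1
height-psiFactor-2 n = trans (cong height (psiFactor-prime n prime[2])) (height-local-2 (val 0 n))

height-psiFactor-odd : ∀ n q → height (psiFactor n (suc q)) ≡ val (suc q) n * weight (suc q)
height-psiFactor-odd n q with prime? (3 + q)
... | yes p-prime =
  trans (cong height (psiFactor-prime n p-prime)) (height-local-oddPrime p-prime (val (suc q) n))
... | no  ¬p      = begin
  height (psiFactor n (suc q))    ≡⟨ cong height (psiFactor-nonprime n ¬p) ⟩
  0                               ≡⟨ *-zeroʳ (val (suc q) n) ⟨
  val (suc q) n * 0               ≡⟨ cong (val (suc q) n *_) (weight-nonprime ¬p) ⟨
  val (suc q) n * weight (suc q)  ∎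
  where open ≡-Reasoning

oddPrimeHeight : ℕ → ℕ
oddPrimeHeight n = sum (applyUpTo (λ r → val (suc r) n * weight (suc r)) (pred n))

height≡val+oddPrimeHeight : ∀ {n} → 1 ≤ n → height n ≡ val 0 n + oddPrimeHeight n
height≡val+oddPrimeHeight {suc n} _ = cong (_+ oddPrimeHeight (suc n)) (*-identityʳ (val 0 (suc n)))

height-psiBar : ∀ {n} → 1 ≤ n → height (psiBar n) ≡ (val 0 n ∸ 1) + oddPrimeHeight n
height-psiBar {suc n} _ = begin
  height (psiBar (suc n))
    ≡⟨ cong height (psiBar≡product (suc n)) ⟩
  height (product (applyUpTo (psiFactor (suc n)) (suc n)))
    ≡⟨ additive-product height height-* (psiFactor (suc n)) (psiFactor-pos (suc n)) (suc n) ⟩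
  height (psiFactor (suc n) 0) + sum (applyUpTo (λ r → height (psiFactor (suc n) (suc r))) n)
    ≡⟨ cong₂ _+_ (height-psiFactor-2 (suc n)) (sum-applyUpTo-cong n λ {r} _ → height-psiFactor-odd (suc n) r) ⟩
  (val 0 (suc n) ∸ 1) + oddPrimeHeight (suc n) ∎
  where open ≡-Reasoning

height-psiBar-odd : ∀ {n} → 1 ≤ n → Odd n → height (psiBar n) ≡ height n
height-psiBar-odd {n} n≥1 n-odd = begin
  height (psiBar n)                   ≡⟨ height-psiBar n≥1 ⟩
  (val 0 n ∸ 1) + oddPrimeHeight n    ≡⟨ cong (λ v → (v ∸ 1) + oddPrimeHeight n) v≡0 ⟩
  oddPrimeHeight n                    ≡⟨ cong (_+ oddPrimeHeight n) v≡0 ⟨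
  val 0 n + oddPrimeHeight n          ≡⟨ height≡val+oddPrimeHeight n≥1 ⟨
  height n                            ∎
  where
    open ≡-Reasoning
    v≡0 : val 0 n ≡ 0
    v≡0 = val-∤ 0 n≥1 n-odd

height-psiBar-even : ∀ {n} → 1 ≤ n → 2 ∣ n → suc (height (psiBar n)) ≡ height n
height-psiBar-even {n} n≥1 2∣n = begin
  suc (height (psiBar n))                ≡⟨ cong suc (height-psiBar n≥1) ⟩
  suc ((val 0 n ∸ 1) + oddPrimeHeight n) ≡⟨ cong (_+ oddPrimeHeight n) (m+[n∸m]≡n (∣⇒val>0 0 n≥1 2∣n)) ⟩
  val 0 n + oddPrimeHeight n             ≡⟨ height≡val+oddPrimeHeight n≥1 ⟨
  height n                               ∎
  where open ≡-Reasoning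

2∣local-2 : ∀ v → 2 ≤ v → 2 ∣ local 2 v
2∣local-2 (suc (suc a)) _        = m∣m*n (2 ^ a)
2∣local-2 1             (s≤s ())

2∣local-oddPrime : ∀ {q} → Prime (3 + q) → ∀ v → 1 ≤ v → 2 ∣ local (3 + q) v
2∣local-oddPrime {q} p-prime (suc a) _ =
  ∣n⇒∣m*n ((3 + q) ^ a) (subst (2 ∣_) (+-comm 1 (3 + q)) (2∣suc-oddPrime p-prime λ ()))

2<2^v⇒2≤v : ∀ v → 2 < 2 ^ v → 2 ≤ v
2<2^v⇒2≤v 0             (s≤s ())
2<2^v⇒2≤v 1             (s≤s (s≤s ()))
2<2^v⇒2≤v (suc (suc _)) _ = s≤s (s≤s z≤n)

psiBar-even : ∀ {n} → 2 < n → 2 ∣ psiBar n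
psiBar-even {n} n>2 = subst (2 ∣_) (sym (psiBar≡product n)) (by-oddPart (val-exactPower 0 n≥1))
  where
    n≥1 : 1 ≤ n
    n≥1 = ≤-trans (s≤s z≤n) n>2
    2∣psiFactor : ∀ {q} → q < n → 2 ∣ psiFactor n q → 2 ∣ product (applyUpTo (psiFactor n) n)
    2∣psiFactor = ∣-product-applyUpTo (psiFactor n)
    -- n = 2 ^ v * m with m odd: an odd prime p ∣ m makes the factor p ^ (a - 1) * (p + 1) even,
    -- and if m = 1 then v ≥ 2 makes the factor 2 ^ (v - 1) even.
    by-oddPart : ExactPower 2 (val 0 n) n → 2 ∣ product (applyUpTo (psiFactor n) n)
    by-oddPart (0 , n≡ , _) = contradiction (trans n≡ (*-zeroʳ (2 ^ val 0 n))) (>⇒≢ n≥1)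
    by-oddPart (1 , n≡ , _) = 2∣psiFactor n≥1 (subst (2 ∣_) (sym (psiFactor-prime n prime[2]))
      (2∣local-2 (val 0 n) (2<2^v⇒2≤v (val 0 n) (subst (2 <_) (trans n≡ (*-identityʳ _)) n>2))))
    by-oddPart (m@(suc (suc _)) , n≡ , m-odd) with oddPrime-factor (s≤s (s≤s z≤n)) m-odd
    ... | q , p-prime , p∣m =
      2∣psiFactor (≤-trans (n≤1+n _) (∣⇒≤ ⦃ >-nonZero n≥1 ⦄ p∣n)) (subst (2 ∣_) (sym (psiFactor-prime n p-prime))
        (2∣local-oddPrime p-prime (val (suc q) n) (∣⇒val>0 (suc q) n≥1 p∣n)))
      where
        p∣n : 3 + q ∣ n
        p∣n = ∣-trans p∣m (divides (2 ^ val 0 n) n≡)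

-- Iterating ψ̄, and λ on odd numbers

iter-suc : ∀ k (f : ℕ → ℕ) n → iter (suc k) f n ≡ iter k f (f n)
iter-suc zero    f n = refl
iter-suc (suc k) f n = cong f (iter-suc k f n)

iter-fixed : ∀ {f : ℕ → ℕ} {b} → f b ≡ b → ∀ k → iter k f b ≡ b
iter-fixed         fb≡b zero    = refl
iter-fixed {f} {b} fb≡b (suc k) = trans (cong f (iter-fixed fb≡b k)) fb≡b

iter-never-returns : ∀ {f : ℕ → ℕ} {a b} → f a ≡ b → f b ≡ b → a ≢ b → ∀ k → iter (suc k) f a ≢ a
iter-never-returns {f} {a} fa≡b fb≡b a≢b k returns =
  a≢b (trans (sym returns) (trans (iter-suc k f a) (trans (cong (iter k f) fa≡b) (iter-fixed fb≡b k))))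

iter-hits-once : ∀ {f : ℕ → ℕ} {a b} → f a ≡ b → f b ≡ b → a ≢ b →
                 ∀ {n} k k' → iter k f n ≡ a → iter k' f n ≡ a → k ≡ k'
iter-hits-once     fa≡b fb≡b a≢b     zero    zero     _    _    = refl
iter-hits-once     fa≡b fb≡b a≢b     zero    (suc k') refl e'   =
  contradiction e' (iter-never-returns fa≡b fb≡b a≢b k')
iter-hits-once     fa≡b fb≡b a≢b     (suc k) zero     e    refl =
  contradiction e (iter-never-returns fa≡b fb≡b a≢b k)
iter-hits-once {f} fa≡b fb≡b a≢b {n} (suc k) (suc k') e    e'   = cong suc
  (iter-hits-once fa≡b fb≡b a≢b k k' (trans (sym (iter-suc k f n)) e) (trans (sym (iter-suc k' f n)) e'))

iter-psiBar-even : ∀ k {n} → 1 ≤ n → 2 ∣ n → height n ≡ suc k → iter k psiBar n ≡ 2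
iter-psiBar-even zero    n≥1 (divides m refl) h≡1 =
  cong (_* 2) (height≡0⇒≡1 m≥1 (suc-injective (trans (sym (height-*2 m≥1)) h≡1)))
  where
    m≥1 : 1 ≤ m
    m≥1 = m*n>0⇒m>0 m n≥1
iter-psiBar-even (suc k) {n} n≥1 2∣n h≡ = begin
  iter (suc k) psiBar n    ≡⟨ iter-suc k psiBar n ⟩
  iter k psiBar (psiBar n) ≡⟨ iter-psiBar-even k (psiBar-pos n) (psiBar-even n>2) h[ψ̄n]≡ ⟩
  2                        ∎
  where
    open ≡-Reasoning
    n>2 : 2 < n
    n>2 = ≤∧≢⇒< (∣⇒≤ ⦃ >-nonZero n≥1 ⦄ 2∣n) λ 2≡n → 0≢1+n (suc-injective (trans (cong height 2≡n) h≡))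
    h[ψ̄n]≡ : height (psiBar n) ≡ suc k
    h[ψ̄n]≡ = suc-injective (trans (height-psiBar-even n≥1 2∣n) h≡)

iter-psiBar-odd : ∀ {n} → 1 < n → Odd n → iter (height n) psiBar n ≡ 2
iter-psiBar-odd {n} n>1 n-odd with height n in h≡ | height-pos n>1
... | suc k | _ = trans (iter-suc k psiBar n)
  (iter-psiBar-even k (psiBar-pos n) (psiBar-even n>2) (trans (height-psiBar-odd n≥1 n-odd) h≡))
  where
    n>2 : 2 < n
    n>2 = ≤∧≢⇒< n>1 λ { refl → n-odd ∣-refl }
    n≥1 : 1 ≤ n
    n≥1 = <-trans z<s n>1

lambda-odd : ∀ {n} → 1 ≤ n → Odd n → LambdaIs n (height n)
lambda-odd {1}           _ _     = inj₁ (refl , refl)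
lambda-odd {suc (suc n)} _ n-odd = inj₂ (s≤s z<s , iter-psiBar-odd (s≤s z<s) n-odd)

lambda-odd-unique : ∀ {n k} → Odd n → LambdaIs n k → height n ≡ k
lambda-odd-unique n-odd (inj₁ (refl , refl)) = refl
lambda-odd-unique n-odd (inj₂ (n>1 , iter≡2)) =
  iter-hits-once {psiBar} refl refl (λ ()) _ _ (iter-psiBar-odd n>1 n-odd) iter≡2

-- Divisors of the numbers B(k)

height-odd≢1 : ∀ {n} → Odd n → height n ≢ 1
height-odd≢1 {0}           n-odd _  = n-odd (divides 0 refl)
height-odd≢1 {suc (suc n)} n-odd h≡1 =
  contradiction (subst (2 ≤_) h≡1 (height-odd≥2 (s≤s z<s) n-odd)) λ { (s≤s ()) }

IsB-height : ∀ {k x} → IsB k x → height x ≡ k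
IsB-height ((x-odd , _ , λx≡k) , _) = lambda-odd-unique x-odd λx≡k

IsB-divisor : ∀ {k x d} → IsB k x → 1 ≤ d → d ∣ x → IsB (height d) d
IsB-divisor {k} {d = d} B@((x-odd , x≥1 , _) , x-max) d≥1 (divides e refl) =
  (d-odd , d≥1 , lambda-odd d≥1 d-odd) , d-max
  where
    e≥1 : 1 ≤ e
    e≥1 = m*n>0⇒m>0 e x≥1
    d-odd : Odd d
    d-odd = odd-∣ x-odd (n∣m*n e)
    d-max : ∀ m → Odd m → 1 ≤ m → LambdaIs m (height d) → m ≤ d
    d-max m m-odd m≥1 λm =
      *-cancelˡ-≤ e ⦃ >-nonZero e≥1 ⦄ (x-max (e * m) em-odd (*-mono-≤ e≥1 m≥1) λem)
      where
        em-odd : Odd (e * m)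
        em-odd = odd-* (odd-∣ x-odd (m∣m*n {e} d)) m-odd
        height-em : height (e * m) ≡ k
        height-em = begin
          height (e * m)       ≡⟨ height-* e≥1 m≥1 ⟩
          height e + height m  ≡⟨ cong (height e +_) (lambda-odd-unique m-odd λm) ⟩
          height e + height d  ≡⟨ height-* e≥1 d≥1 ⟨
          height (e * d)       ≡⟨ IsB-height B ⟩
          k                    ∎
          where open ≡-Reasoning
        λem : LambdaIs (e * m) k
        λem = subst (LambdaIs (e * m)) height-em (lambda-odd (*-mono-≤ e≥1 m≥1) em-odd)

theorem2p5 : ∀ x → InℬB x → ∀ d → 1 ≤ d → d ∣ x → InℬB d
theorem2p5 x (k , _ , x-B@((x-odd , _) , _)) d d≥1 d∣x =
  height d , height-odd≢1 (odd-∣ x-odd d∣x) , IsB-divisor x-B d≥1 d∣x
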